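{- Let $D=1$ and $A\ge1$. Let $N=n_\lambda\dots n_0$ and $N'=n'_\lambda\dots n'_0$ be digit strings with digits in $\{ -1,0,1\}$, and let $0<i\le j\le\lambda$. Suppose $n_k=n'_k$ for all $i\le k\le j$, there exist $0\le p,q<i$ with $n_p\ne0$ and $n'_q\ne0$, and $\delta(N,i-1)\ge\delta(N',i-1)$. Then $\delta(N,j)\ge\delta(N',j)$.
   Context: Time model with doubling time $D$ and addition time $A$: for a digit string $N=n_\lambda\dots n_0$, define recursively for $0\le i\le\lambda$: $T(N,i)=0$ if $i=0$ and $n_0=0$; $T(N,i)=T(N,i-1)$ if $i>0$ and $n_i=0$; $T(N,i)=iD+(|n_i|-1)A$ if $n_i\ne0$ and $n_j=0$ for all $0\le j<i$; and $T(N,i)=\max(T(N,i-1),iD)+|n_i|A$ otherwise. With $D=1$, the delay is $\delta(N,i)=T(N,i)-i$. -}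

module Defs where

open import Data.Nat using (ℕ; zero; suc)
open import Data.Integer using (ℤ; +_; _+_; _-_; _*_; _⊔_)
open import Data.Bool using (Bool; true; false; _∧_)

data Digit : Set where
  neg zer pos : Digit

absD : Digit → ℕ
absD neg = 1
absD zer = 0
absD pos = 1

isZero : Digit → Bool
isZero zer = true
isZero _   = false

-- A digit string n_λ … n_0 is given by its digit function k ↦ n_k
-- (only the values at indices 0 … λ are ever used).
DigitString : Set
DigitString = ℕ → Digit

allZeroBelow : DigitString → ℕ → Bool
allZeroBelow N zero    = true
allZeroBelow N (suc i) = allZeroBelow N i ∧ isZero (N i)

-- Time T(N,i) with doubling time D and addition time A (integers).
mutual
  T : (D A : ℤ) → DigitString → ℕ → ℤ
  T D A N i = Tcase D A N i (N i)

  Tcase : (D A : ℤ) → DigitString → ℕ → Digit → ℤ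
  Tcase D A N zero    zer = + 0
  Tcase D A N (suc i) zer = T D A N i
  Tcase D A N zero    d   = + 0 * D + (+ absD d - + 1) * A
  Tcase D A N (suc i) d with allZeroBelow N (suc i)
  ... | true  = + suc i * D + (+ absD d - + 1) * A
  ... | false = (T D A N i ⊔ + suc i * D) + + absD d * A

δ : (A : ℤ) → DigitString → ℕ → ℤ
δ A N i = T (+ 1) A N i - + i

{-# OPTIONS --safe #-}
-- For k ≥ i both strings have a nonzero digit below k, so the "first nonzero
-- digit" case of the recursion never fires again: T(N,k) is either T(N,k-1)
-- or max(T(N,k-1), k) + |n_k| A. Both are monotone in T(N,k-1), and N and N'
-- share the digit n_k, so T(N',i-1) ≤ T(N,i-1) propagates up to position j.
-- Since δ(·,k) is T(·,k) shifted by the same -k, the same holds for δ.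
module Submission where

open import Defs
open import Data.Nat using (ℕ; _≤_; _<_; pred; suc; s≤s; _≤′_; ≤′-refl; ≤′-step)
open import Data.Nat.Properties using (m≤n⇒m<n∨m≡n; ≤⇒≤′; ≤′⇒≤; <⇒≤; m≤n⇒m≤1+n; ≤-refl; ≤-trans)
open import Data.Integer using (ℤ; +_; -_; _-_) renaming (_≤_ to _≤ℤ_)
open import Data.Integer.Properties using (+-monoˡ-≤; ⊔-monoˡ-≤; +-0-abelianGroup)
open import Algebra.Properties.AbelianGroup +-0-abelianGroup using (//-rightDividesˡ)
open import Data.Bool using (false; _∧_)
open import Data.Bool.Properties using (∧-zeroʳ)
open import Data.Product using (∃; _×_; _,_)
open import Data.Sum using (inj₁; inj₂)
open import Data.Empty using (⊥-elim)
open import Relation.Binary.PropositionalEquality using (_≡_; _≢_; refl; sym; cong; subst; subst₂)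

NonzeroBelow : DigitString → ℕ → Set
NonzeroBelow N i = ∃ λ p → p < i × N p ≢ zer

NonzeroBelow-mono : ∀ {N i j} → i ≤ j → NonzeroBelow N i → NonzeroBelow N j
NonzeroBelow-mono i≤j (p , p<i , np≢0) = p , ≤-trans p<i i≤j , np≢0

allZeroBelow-false : ∀ {N i} → NonzeroBelow N i → allZeroBelow N i ≡ false
allZeroBelow-false {N} {suc i} (p , s≤s p≤i , np≢0) with m≤n⇒m<n∨m≡n p≤i
... | inj₁ p<i rewrite allZeroBelow-false {N} {i} (p , p<i , np≢0) = refl
... | inj₂ refl = last-digit-nonzero (N p) np≢0
  where
  last-digit-nonzero : ∀ d → d ≢ zer → allZeroBelow N p ∧ isZero d ≡ false
  last-digit-nonzero neg _   = ∧-zeroʳ _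
  last-digit-nonzero zer d≢0 = ⊥-elim (d≢0 refl)
  last-digit-nonzero pos _   = ∧-zeroʳ _

module _ (D A : ℤ) where

  Tcase-suc-mono : ∀ {N N' m} d → NonzeroBelow N (suc m) → NonzeroBelow N' (suc m)
    → T D A N' m ≤ℤ T D A N m → Tcase D A N' (suc m) d ≤ℤ Tcase D A N (suc m) d
  Tcase-suc-mono zer _ _ T≤ = T≤
  Tcase-suc-mono neg nz nz' T≤
    rewrite allZeroBelow-false nz | allZeroBelow-false nz' = +-monoˡ-≤ _ (⊔-monoˡ-≤ _ T≤)
  Tcase-suc-mono pos nz nz' T≤
    rewrite allZeroBelow-false nz | allZeroBelow-false nz' = +-monoˡ-≤ _ (⊔-monoˡ-≤ _ T≤)

  T-suc-mono : ∀ {N N' m} → N (suc m) ≡ N' (suc m)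
    → NonzeroBelow N (suc m) → NonzeroBelow N' (suc m)
    → T D A N' m ≤ℤ T D A N m → T D A N' (suc m) ≤ℤ T D A N (suc m)
  T-suc-mono {N} {N'} {m} same-digit nz nz' T≤ =
    subst (T D A N' (suc m) ≤ℤ_) (cong (Tcase D A N (suc m)) (sym same-digit))
      (Tcase-suc-mono (N' (suc m)) nz nz' T≤)

  T-mono-from : ∀ {N N' i j} → i ≤′ j
    → (∀ k → suc i ≤ k → k ≤ j → N k ≡ N' k)
    → NonzeroBelow N (suc i) → NonzeroBelow N' (suc i)
    → T D A N' i ≤ℤ T D A N i → T D A N' j ≤ℤ T D A N j
  T-mono-from ≤′-refl _ _ _ T≤ = T≤
  T-mono-from {j = suc m} (≤′-step i≤′m) agree nz nz' T≤ =
    T-suc-mono (agree (suc m) i<1+m ≤-refl)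
      (NonzeroBelow-mono i<1+m nz) (NonzeroBelow-mono i<1+m nz')
      (T-mono-from i≤′m (λ k i<k k≤m → agree k i<k (m≤n⇒m≤1+n k≤m)) nz nz' T≤)
    where
    i<1+m = s≤s (≤′⇒≤ i≤′m)

-‿cancelʳ-≤ : ∀ {a b} c → a - c ≤ℤ b - c → a ≤ℤ b
-‿cancelʳ-≤ {a} {b} c a-c≤b-c =
  subst₂ _≤ℤ_ (//-rightDividesˡ c a) (//-rightDividesˡ c b) (+-monoˡ-≤ c a-c≤b-c)

lemma1 : (A : ℤ) → + 1 ≤ℤ A → (λ' : ℕ) → (N N' : DigitString) → (i j : ℕ)
    → 0 < i → i ≤ j → j ≤ λ'
    → (∀ k → i ≤ k → k ≤ j → N k ≡ N' k)
    → (∃ λ p → p < i × N p ≢ zer) → (∃ λ q → q < i × N' q ≢ zer)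
    → δ A N' (pred i) ≤ℤ δ A N (pred i)
    → δ A N' j ≤ℤ δ A N j
lemma1 A _ _ N N' (suc i) j _ i<j _ agree nz nz' δ≤ =
  +-monoˡ-≤ (- + j)
    (T-mono-from (+ 1) A (≤⇒≤′ (<⇒≤ i<j)) agree nz nz' (-‿cancelʳ-≤ (+ i) δ≤))
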